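{- Let $p\neq 0$ and $q$ be integers and let $n\ge 0$ be an integer. Then \[ \sum_{j = 0}^n P_{pj + q} = \frac{\begin{vmatrix} P_{pn + p + q} - P_q & P_{p - 3} & P_{p - 4} \\ P_{pn + p + q + 1} - P_{q + 1} & P_{p - 2} - 1 & P_{p - 3} \\ P_{pn + p + q - 1} - P_{q - 1} & P_{p - 4} & P_{p - 5} - 1 \end{vmatrix}}{\begin{vmatrix} P_{p - 2} - 1 & P_{p - 3} & P_{p - 4} \\ P_{p - 1} & P_{p - 2} - 1 & P_{p - 3} \\ P_{p - 3} & P_{p - 4} & P_{p - 5} - 1 \end{vmatrix}} \] and \[ \sum_{j = 0}^n Q_{pj + q} = \frac{\begin{vmatrix} Q_{pn + p + q} - Q_q & P_{p - 3} & P_{p - 4} \\ Q_{pn + p + q + 1} - Q_{q + 1} & P_{p - 2} - 1 & P_{p - 3} \\ Q_{pn + p + q - 1} - Q_{q - 1} & P_{p - 4} & P_{p - 5} - 1 \end{vmatrix}}{\begin{vmatrix} P_{p - 2} - 1 & P_{p - 3} & P_{p - 4} \\ P_{p - 1} & P_{p - 2} - 1 & P_{p - 3} \\ P_{p - 3} & P_{p - 4} & P_{p - 5} - 1 \end{vmatrix}}. \] In particular $\sum_{j=0}^n P_{j+q}=P_{n+q+5}-P_{q+4}$ and $\sum_{j=0}^n Q_{j+q}=Q_{n+q+5}-Q_{q+4}$.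
   Context: The Padovan numbers $P_n$ are defined for all integers $n$ by $P_0=P_1=P_2=1$ and $P_n=P_{n-2}+P_{n-3}$ for all integers $n$ (the recurrence, written as $P_n=P_{n+3}-P_{n+1}$, extends the sequence to negative indices). The Perrin numbers $Q_n$ are defined for all integers $n$ by $Q_0=3$, $Q_1=0$, $Q_2=2$ and $Q_n=Q_{n-2}+Q_{n-3}$ for all integers $n$. -}

module Defs where

open import Data.Nat using (ℕ; zero; suc)
open import Data.Integer using (ℤ; +_; -[1+_]; _+_; _-_; _*_; -_)
open import Data.Product using (_×_; _,_; proj₁)

-- A linear recurrence x_n = x_{n-2} + x_{n-3} on ℤ, determined by
-- its initial values (x_0, x_1, x_2).
-- Forward: triple (x_k, x_{k+1}, x_{k+2}).
fwd : ℤ × ℤ × ℤ → ℕ → ℤ × ℤ × ℤ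
fwd t zero = t
fwd t (suc k) with fwd t k
... | (a , b , c) = (b , c , a + b)

-- Backward: triple (x_{-k}, x_{-k+1}, x_{-k+2}), using x_n = x_{n+3} - x_{n+1}.
bwd : ℤ × ℤ × ℤ → ℕ → ℤ × ℤ × ℤ
bwd t zero = t
bwd t (suc k) with bwd t k
... | (a , b , c) = (c - a , a , b)

seqℤ : ℤ × ℤ × ℤ → ℤ → ℤ
seqℤ t (+ k) = proj₁ (fwd t k)
seqℤ t -[1+ k ] = proj₁ (bwd t (suc k))

P : ℤ → ℤ
P = seqℤ (+ 1 , + 1 , + 1)

Q : ℤ → ℤ
Q = seqℤ (+ 3 , + 0 , + 2)

sumTo : ℕ → (ℕ → ℤ) → ℤ
sumTo zero f = f 0
sumTo (suc n) f = sumTo n f + f (suc n)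

det3 : ℤ → ℤ → ℤ → ℤ → ℤ → ℤ → ℤ → ℤ → ℤ → ℤ
det3 a b c d e f g h i =
  a * (e * i - f * h) - b * (d * i - f * g) + c * (d * h - e * g)

denom : ℤ → ℤ
denom p = det3 (P (p - + 2) - + 1) (P (p - + 3)) (P (p - + 4))
               (P (p - + 1)) (P (p - + 2) - + 1) (P (p - + 3))
               (P (p - + 3)) (P (p - + 4)) (P (p - + 5) - + 1)

numer : (ℤ → ℤ) → ℤ → ℤ → ℕ → ℤ
numer X p q n =
  let m = p * + n + p + q in
  det3 (X m - X q) (P (p - + 3)) (P (p - + 4))
       (X (m + + 1) - X (q + + 1)) (P (p - + 2) - + 1) (P (p - + 3))
       (X (m - + 1) - X (q - + 1)) (P (p - + 4)) (P (p - + 5) - + 1)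

module Submission where

-- P and Q solve x (n + 3) = x (n + 1) + x n on ℤ, and a solution is determined by
-- its values at -1, 0, 1.  This uniqueness gives the addition formula
-- X (k + p) = P (p - 2) X k + P (p - 3) X (k + 1) + P (p - 4) X (k - 1): the window
-- (X (k + p), X (k + 1 + p), X (k - 1 + p)) is a Padovan matrix M(p) applied to
-- (X k, X (k + 1), X (k - 1)).  Sampling X along p j + q and telescoping, the three
-- partial sums solve (M(p) - I) s = (end-point differences), and Cramer's rule is the
-- sum formula, as denom p = det (M(p) - I).  For denom p ≠ 0 (p ≠ 0): a kernel
-- vector of M(p) - I is the window (X 0, X 1, X -1) of a p-periodic solution; along
-- a solution the energy -2x² - y² - z² + 2xz + 2yz of (X k, X (k+1), X (k+2)) grows
-- by X k², so a periodic solution vanishes.  Thus the kernel is trivial, and a 3×3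
-- matrix with trivial kernel is non-singular (via its adjugate).  The case p = 1 is
-- a direct telescoping with x (n + 5) = x (n + 4) + x n.

open import Defs
open import Data.Nat using (ℕ; zero; suc; z≤n)
import Data.Nat.Properties as ℕP
open import Data.Integer using (ℤ; +_; -[1+_]; _+_; _-_; _*_; -_; _≤_; +≤+)
import Data.Integer.Properties as ℤP
open import Data.Integer.Tactic.RingSolver using (solve-∀)
open import Data.Product using (_×_; _,_; proj₁; proj₂)
open import Data.Sum using ([_,_]′)
open import Data.Empty using (⊥-elim)
open import Function using (id)
open import Relation.Binary.PropositionalEquality
open ≡-Reasoning

add-difference : ∀ x y → x ≡ y + (x - y)
add-difference = solve-∀

difference : ∀ {x y d} → y ≡ x + d → y - x ≡ d
difference {x} {d = d} refl = cancel x d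
  where
  cancel : ∀ x d → x + d - x ≡ d
  cancel = solve-∀

combination-cong : ∀ {a a′ b b′ c c′} x y z → a ≡ a′ → b ≡ b′ → c ≡ c′ →
                   a * x + b * y + c * z ≡ a′ * x + b′ * y + c′ * z
combination-cong x y z refl refl refl = refl

record Rec (f : ℤ → ℤ) : Set where
  field
    recurrence : ∀ n → f (n + + 3) ≡ f (n + + 1) + f n
open Rec

-- Every sequence built by seqℤ solves the recurrence; on the negative side this is
-- the defining equation x n = x (n + 3) - x (n + 1) of the backward extension.
seqℤ-rec : ∀ t → Rec (seqℤ t)
recurrence (seqℤ-rec t) (+ k) rewrite ℕP.+-comm k 3 | ℕP.+-comm k 1 =
  ℤP.+-comm (proj₁ (fwd t k)) (proj₁ (proj₂ (fwd t k)))
recurrence (seqℤ-rec t) -[1+ 0 ]         = add-difference _ (seqℤ t (+ 0))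
recurrence (seqℤ-rec t) -[1+ 1 ]         = add-difference _ (seqℤ t -[1+ 0 ])
recurrence (seqℤ-rec t) -[1+ 2 ]         = add-difference _ (seqℤ t -[1+ 1 ])
recurrence (seqℤ-rec t) -[1+ suc (suc (suc k)) ] =
  add-difference _ (seqℤ t -[1+ suc (suc k) ])

P-rec : Rec P
P-rec = seqℤ-rec _

Q-rec : Rec Q
Q-rec = seqℤ-rec _

rec-ℕ : ∀ {f} → Rec f → ∀ i → f (+ suc (suc (suc i))) ≡ f (+ suc i) + f (+ i)
rec-ℕ {f} R i =
  subst₂ (λ a b → f (+ a) ≡ f (+ b) + f (+ i)) (ℕP.+-comm i 3) (ℕP.+-comm i 1) (recurrence R (+ i))

rec-ext : ∀ {f g} → (∀ n → f n ≡ g n) → Rec f → Rec g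
recurrence (rec-ext {f} {g} f≡g R) n = begin
  g (n + + 3)          ≡⟨ sym (f≡g _) ⟩
  f (n + + 3)          ≡⟨ recurrence R n ⟩
  f (n + + 1) + f n    ≡⟨ cong₂ _+_ (f≡g _) (f≡g n) ⟩
  g (n + + 1) + g n    ∎

shift : ℤ → (ℤ → ℤ) → ℤ → ℤ
shift c f n = f (c + n)

rec-shift : ∀ {f} → Rec f → ∀ c → Rec (shift c f)
recurrence (rec-shift {f} R c) n = begin
  f (c + (n + + 3))            ≡⟨ cong f (sym (ℤP.+-assoc c n (+ 3))) ⟩
  f (c + n + + 3)              ≡⟨ recurrence R (c + n) ⟩
  f (c + n + + 1) + f (c + n)  ≡⟨ cong (λ m → f m + f (c + n)) (ℤP.+-assoc c n (+ 1)) ⟩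
  f (c + (n + + 1)) + f (c + n) ∎

rec-combination : ∀ {f g h} → Rec f → Rec g → Rec h → ∀ x y z →
                  Rec (λ n → f n * x + g n * y + h n * z)
recurrence (rec-combination {f} {g} {h} Rf Rg Rh x y z) n
  rewrite recurrence Rf n | recurrence Rg n | recurrence Rh n =
    regroup (f (n + + 1)) (f n) (g (n + + 1)) (g n) (h (n + + 1)) (h n) x y z
  where
  regroup : ∀ a b c d e f x y z →
    (a + b) * x + (c + d) * y + (e + f) * z ≡ a * x + c * y + e * z + (b * x + d * y + f * z)
  regroup = solve-∀

Agree : (f g : ℤ → ℤ) → Set
Agree f g = f -[1+ 0 ] ≡ g -[1+ 0 ] × f (+ 0) ≡ g (+ 0) × f (+ 1) ≡ g (+ 1)

agree-right : ∀ {f g} → Rec f → Rec g → Agree f g → Agree (shift (+ 1) f) (shift (+ 1) g)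
agree-right Rf Rg (e₋ , e₀ , e₁) =
  e₀ , e₁ , trans (recurrence Rf -[1+ 0 ]) (trans (cong₂ _+_ e₀ e₋) (sym (recurrence Rg -[1+ 0 ])))

agree-left : ∀ {f g} → Rec f → Rec g → Agree f g → Agree (shift -[1+ 0 ] f) (shift -[1+ 0 ] g)
agree-left {f} {g} Rf Rg (e₋ , e₀ , e₁) = e₋₂ , e₋ , e₀
  where
  e₋₂ : f -[1+ 1 ] ≡ g -[1+ 1 ]
  e₋₂ = begin
    f -[1+ 1 ]              ≡⟨ sym (difference (recurrence Rf -[1+ 1 ])) ⟩
    f (+ 1) - f -[1+ 0 ]    ≡⟨ cong₂ _-_ e₁ e₋ ⟩
    g (+ 1) - g -[1+ 0 ]    ≡⟨ difference (recurrence Rg -[1+ 1 ]) ⟩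
    g -[1+ 1 ]              ∎

rec-unique : ∀ {f g} → Rec f → Rec g → Agree f g → ∀ n → f n ≡ g n
rec-unique Rf Rg (_ , e₀ , _) (+ zero) = e₀
rec-unique Rf Rg A (+ suc k) =
  rec-unique (rec-shift Rf (+ 1)) (rec-shift Rg (+ 1)) (agree-right Rf Rg A) (+ k)
rec-unique Rf Rg (e₋ , _ , _) -[1+ zero ] = e₋
rec-unique Rf Rg A -[1+ suc k ] =
  rec-unique (rec-shift Rf -[1+ 0 ]) (rec-shift Rg -[1+ 0 ]) (agree-left Rf Rg A) -[1+ k ]

P-shifted-rec : ∀ c → Rec (λ p → P (p - c))
P-shifted-rec c = rec-ext (λ n → cong P (ℤP.+-comm (- c) n)) (rec-shift P-rec (- c))

-- The addition formula: both sides solve the recurrence in p and agree at p = -1, 0, 1.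
addition : ∀ {X} → Rec X → ∀ k p →
  X (k + p) ≡ P (p - + 2) * X k + P (p - + 3) * X (k + + 1) + P (p - + 4) * X (k - + 1)
addition {X} RX k =
  rec-unique (rec-shift RX k)
    (rec-combination (P-shifted-rec (+ 2)) (P-shifted-rec (+ 3)) (P-shifted-rec (+ 4))
                     (X k) (X (k + + 1)) (X (k - + 1)))
    (pick₃ (X k) (X (k + + 1)) (X (k - + 1)) ,
     trans (cong X (ℤP.+-identityʳ k)) (pick₁ (X k) (X (k + + 1)) (X (k - + 1))) ,
     pick₂ (X k) (X (k + + 1)) (X (k - + 1)))
  where
  -- at p = -1, 0, 1 the coefficient vector is a unit vector
  pick₁ : ∀ x y z → x ≡ + 1 * x + + 0 * y + + 0 * z
  pick₁ = solve-∀
  pick₂ : ∀ x y z → y ≡ + 0 * x + + 1 * y + + 0 * z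
  pick₂ = solve-∀
  pick₃ : ∀ x y z → z ≡ + 0 * x + + 0 * y + + 1 * z
  pick₃ = solve-∀

-- The addition formula started at k + u; the offsets u = 0, 1, -1 give the three
-- rows of the matrix M(p) with rows (P (p-2), P (p-3), P (p-4)),
-- (P (p-1), P (p-2), P (p-3)) and (P (p-3), P (p-4), P (p-5)).
addition-row : ∀ {X} → Rec X → ∀ k u p →
  X (k + u + p) ≡ P (p - (+ 2 - u)) * X k + P (p - (+ 3 - u)) * X (k + + 1)
                  + P (p - (+ 4 - u)) * X (k - + 1)
addition-row {X} RX k u p = begin
  X (k + u + p)    ≡⟨ cong X (ℤP.+-assoc k u p) ⟩
  X (k + (u + p))  ≡⟨ addition RX k (u + p) ⟩
  P (u + p - + 2) * X k + P (u + p - + 3) * X (k + + 1) + P (u + p - + 4) * X (k - + 1)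
    ≡⟨ combination-cong (X k) (X (k + + 1)) (X (k - + 1))
         (cong P (reindex u p (+ 2))) (cong P (reindex u p (+ 3))) (cong P (reindex u p (+ 4))) ⟩
  P (p - (+ 2 - u)) * X k + P (p - (+ 3 - u)) * X (k + + 1) + P (p - (+ 4 - u)) * X (k - + 1) ∎
  where
  reindex : ∀ u p c → u + p - c ≡ p - (c - u)
  reindex = solve-∀

telescope : ∀ (F G : ℕ → ℤ) → (∀ j → F (suc j) ≡ F j + G j) → ∀ n → F (suc n) - F 0 ≡ sumTo n G
telescope F G step zero = difference (step 0)
telescope F G step (suc n) = begin
  F (suc (suc n)) - F 0                              ≡⟨ split (F 0) (F (suc n)) (F (suc (suc n))) ⟩
  (F (suc n) - F 0) + (F (suc (suc n)) - F (suc n))  ≡⟨ cong₂ _+_ (telescope F G step n)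
                                                                  (difference (step (suc n))) ⟩
  sumTo n G + G (suc n)                              ∎
  where
  split : ∀ x m y → y - x ≡ (m - x) + (y - m)
  split = solve-∀

sumTo-linear : ∀ (F G H K : ℕ → ℤ) a b c n →
  sumTo n (λ j → a * G j + b * H j + c * K j - F j)
    ≡ a * sumTo n G + b * sumTo n H + c * sumTo n K - sumTo n F
sumTo-linear F G H K a b c zero = refl
sumTo-linear F G H K a b c (suc n) =
  trans (cong (_+ (a * G (suc n) + b * H (suc n) + c * K (suc n) - F (suc n)))
              (sumTo-linear F G H K a b c n))
        (collect a b c (sumTo n G) (sumTo n H) (sumTo n K) (sumTo n F)
                 (G (suc n)) (H (suc n)) (K (suc n)) (F (suc n)))
  where
  collect : ∀ a b c sg sh sk sf g h k f →
    a * sg + b * sh + c * sk - sf + (a * g + b * h + c * k - f)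
      ≡ a * (sg + g) + b * (sh + h) + c * (sk + k) - (sf + f)
  collect = solve-∀

sum-of-steps : ∀ (F G H K : ℕ → ℤ) a b c → (∀ j → F (suc j) ≡ a * G j + b * H j + c * K j) →
  ∀ n → F (suc n) - F 0 ≡ a * sumTo n G + b * sumTo n H + c * sumTo n K - sumTo n F
sum-of-steps F G H K a b c step n =
  trans (telescope F _ (λ j → trans (step j) (add-difference _ (F j))) n)
        (sumTo-linear F G H K a b c n)

cramer : ∀ a b c d e f g h i {x y z r s t} →
  r ≡ a * x + b * y + c * z - x → s ≡ d * x + e * y + f * z - y → t ≡ g * x + h * y + i * z - z →
  x * det3 (a - + 1) b c d (e - + 1) f g h (i - + 1) ≡ det3 r b c s (e - + 1) f t h (i - + 1)
cramer a b c d e f g h i {x} {y} {z} refl refl refl = expansion a b c d e f g h i x y z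
  where
  expansion : ∀ a b c d e f g h i x y z →
    x * ((a - + 1) * ((e - + 1) * (i - + 1) - f * h) - b * (d * (i - + 1) - f * g)
         + c * (d * h - (e - + 1) * g))
    ≡ (a * x + b * y + c * z - x) * ((e - + 1) * (i - + 1) - f * h)
      - b * ((d * x + e * y + f * z - y) * (i - + 1) - f * (g * x + h * y + i * z - z))
      + c * ((d * x + e * y + f * z - y) * h - (e - + 1) * (g * x + h * y + i * z - z))
  expansion = solve-∀

det3-cong₁ : ∀ {r r′ s s′ t t′} b c e f h i → r ≡ r′ → s ≡ s′ → t ≡ t′ →
             det3 r b c s e f t h i ≡ det3 r′ b c s′ e f t′ h i
det3-cong₁ b c e f h i refl refl refl = refl

module Matrix3 (a b c d e f g h i : ℤ) where

  Kernel : ℤ → ℤ → ℤ → Set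
  Kernel x y z = (a * x + b * y + c * z ≡ + 0) × (d * x + e * y + f * z ≡ + 0)
                 × (g * x + h * y + i * z ≡ + 0)

  TrivialKernel : Set
  TrivialKernel = ∀ x y z → Kernel x y z → x ≡ + 0 × y ≡ + 0 × z ≡ + 0

  -- For a singular matrix the columns of the adjugate lie in the kernel; if the
  -- kernel is trivial they vanish, in particular the minors of columns 1 and 3.
  minors₁₃-vanish : TrivialKernel → det3 a b c d e f g h i ≡ + 0 →
                    (d * i - f * g ≡ + 0) × (a * i - c * g ≡ + 0) × (a * f - c * d ≡ + 0)
  minors₁₃-vanish trivial singular =
    middle (trivial _ _ _ (trans (col₁-row₁ a b c d e f g h i) (cong -_ singular) ,
                           col₁-row₂ a b c d e f g h i , col₁-row₃ a b c d e f g h i)) ,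
    middle (trivial _ _ _ (col₂-row₁ a b c d e f g h i ,
                           trans (col₂-row₂ a b c d e f g h i) singular , col₂-row₃ a b c d e f g h i)) ,
    middle (trivial _ _ _ (col₃-row₁ a b c d e f g h i , col₃-row₂ a b c d e f g h i ,
                           trans (col₃-row₃ a b c d e f g h i) (cong -_ singular)))
    where
    middle : ∀ {x y z : ℤ} → x ≡ + 0 × y ≡ + 0 × z ≡ + 0 → y ≡ + 0
    middle v = proj₁ (proj₂ v)
    -- the adjugate columns, columns 1 and 3 negated so that the minors appear with sign +
    col₁-row₁ : ∀ a b c d e f g h i →
      a * (f * h - e * i) + b * (d * i - f * g) + c * (e * g - d * h)
        ≡ - (a * (e * i - f * h) - b * (d * i - f * g) + c * (d * h - e * g))
    col₁-row₁ = solve-∀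
    col₁-row₂ : ∀ a b c d e f g h i → d * (f * h - e * i) + e * (d * i - f * g) + f * (e * g - d * h) ≡ + 0
    col₁-row₂ = solve-∀
    col₁-row₃ : ∀ a b c d e f g h i → g * (f * h - e * i) + h * (d * i - f * g) + i * (e * g - d * h) ≡ + 0
    col₁-row₃ = solve-∀
    col₂-row₁ : ∀ a b c d e f g h i → a * (c * h - b * i) + b * (a * i - c * g) + c * (b * g - a * h) ≡ + 0
    col₂-row₁ = solve-∀
    col₂-row₂ : ∀ a b c d e f g h i →
      d * (c * h - b * i) + e * (a * i - c * g) + f * (b * g - a * h)
        ≡ a * (e * i - f * h) - b * (d * i - f * g) + c * (d * h - e * g)
    col₂-row₂ = solve-∀
    col₂-row₃ : ∀ a b c d e f g h i → g * (c * h - b * i) + h * (a * i - c * g) + i * (b * g - a * h) ≡ + 0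
    col₂-row₃ = solve-∀
    col₃-row₁ : ∀ a b c d e f g h i → a * (c * e - b * f) + b * (a * f - c * d) + c * (b * d - a * e) ≡ + 0
    col₃-row₁ = solve-∀
    col₃-row₂ : ∀ a b c d e f g h i → d * (c * e - b * f) + e * (a * f - c * d) + f * (b * d - a * e) ≡ + 0
    col₃-row₂ = solve-∀
    col₃-row₃ : ∀ a b c d e f g h i →
      g * (c * e - b * f) + h * (a * f - c * d) + i * (b * d - a * e)
        ≡ - (a * (e * i - f * h) - b * (d * i - f * g) + c * (d * h - e * g))
    col₃-row₃ = solve-∀

  -- If moreover the minors of columns 1 and 3 vanish, then (-c, 0, a), (-f, 0, d)
  -- and (-i, 0, g) are kernel vectors, so the first column is zero.
  column₁-vanishes : TrivialKernel → d * i - f * g ≡ + 0 → a * i - c * g ≡ + 0 → a * f - c * d ≡ + 0 →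
                     (a ≡ + 0) × (d ≡ + 0) × (g ≡ + 0)
  column₁-vanishes trivial m₁ m₂ m₃ =
    last (trivial (- c) (+ 0) a (entry a b c a c (commutes a c) , entry d e f a c m₃ ,
                                 entry g h i a c m₂)) ,
    last (trivial (- f) (+ 0) d (entry a b c d f (opposite a f c d m₃) , entry d e f d f (commutes d f) ,
                                 entry g h i d f m₁)) ,
    last (trivial (- i) (+ 0) g (entry a b c g i (opposite a i c g m₂) ,
                                 entry d e f g i (opposite d i f g m₁) , entry g h i g i (commutes g i)))
    where
    last : ∀ {x y z : ℤ} → x ≡ + 0 × y ≡ + 0 × z ≡ + 0 → z ≡ + 0
    last v = proj₂ (proj₂ v)
    entry : ∀ u v w p q → p * w - q * u ≡ + 0 → u * (- q) + v * + 0 + w * p ≡ + 0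
    entry u v w p q m = trans (expand u v w p q) m
      where
      expand : ∀ u v w p q → u * (- q) + v * + 0 + w * p ≡ p * w - q * u
      expand = solve-∀
    commutes : ∀ p q → p * q - q * p ≡ + 0
    commutes = solve-∀
    opposite : ∀ u v x y → u * v - x * y ≡ + 0 → y * x - v * u ≡ + 0
    opposite u v x y m = trans (negate u v x y) (cong -_ m)
      where
      negate : ∀ u v x y → y * x - v * u ≡ - (u * v - x * y)
      negate = solve-∀

  -- A matrix with trivial kernel is non-singular: otherwise its first column is
  -- zero and (1, 0, 0) is a non-zero kernel vector.
  det3-nonzero : TrivialKernel → det3 a b c d e f g h i ≢ + 0
  det3-nonzero trivial singular =
    let (m₁ , m₂ , m₃)    = minors₁₃-vanish trivial singular
        (a≡0 , d≡0 , g≡0) = column₁-vanishes trivial m₁ m₂ m₃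
    in one≢zero (proj₁ (trivial (+ 1) (+ 0) (+ 0) (unit b c a≡0 , unit e f d≡0 , unit h i g≡0)))
    where
    one≢zero : + 1 ≢ + 0
    one≢zero ()
    unit : ∀ {u} v w → u ≡ + 0 → u * + 1 + v * + 0 + w * + 0 ≡ + 0
    unit {u} v w u≡0 = trans (first u v w) u≡0
      where
      first : ∀ u v w → u * + 1 + v * + 0 + w * + 0 ≡ u
      first = solve-∀

module SumFormula {X : ℤ → ℤ} (RX : Rec X) (p q : ℤ) where

  U V W : ℕ → ℤ
  U j = X (p * + j + q)
  V j = X (p * + j + q + + 1)
  W j = X (p * + j + q - + 1)

  private
    next : ∀ p j q u → p * (+ 1 + j) + q + u ≡ p * j + q + u + p
    next = solve-∀

  U-step : ∀ j → U (suc j) ≡ P (p - + 2) * U j + P (p - + 3) * V j + P (p - + 4) * W j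
  U-step j = trans (cong X (trans (sym (ℤP.+-identityʳ _)) (next p (+ j) q (+ 0))))
                   (addition-row RX (p * + j + q) (+ 0) p)

  V-step : ∀ j → V (suc j) ≡ P (p - + 1) * U j + P (p - + 2) * V j + P (p - + 3) * W j
  V-step j = trans (cong X (next p (+ j) q (+ 1))) (addition-row RX (p * + j + q) (+ 1) p)

  W-step : ∀ j → W (suc j) ≡ P (p - + 3) * U j + P (p - + 4) * V j + P (p - + 5) * W j
  W-step j = trans (cong X (next p (+ j) q -[1+ 0 ])) (addition-row RX (p * + j + q) -[1+ 0 ] p)

  endpoint : ∀ n → p * + suc n + q ≡ p * + n + p + q
  endpoint n = last p (+ n) q
    where
    last : ∀ p n q → p * (+ 1 + n) + q ≡ p * n + p + q
    last = solve-∀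

  startpoint : p * + 0 + q ≡ q
  startpoint = first p q
    where
    first : ∀ p q → p * + 0 + q ≡ q
    first = solve-∀

  sum-formula : ∀ n → sumTo n U * denom p ≡ numer X p q n
  sum-formula n =
    trans (cramer (P (p - + 2)) (P (p - + 3)) (P (p - + 4)) (P (p - + 1)) (P (p - + 2)) (P (p - + 3))
                  (P (p - + 3)) (P (p - + 4)) (P (p - + 5))
                  (sum-of-steps U U V W (P (p - + 2)) (P (p - + 3)) (P (p - + 4)) U-step n)
                  (sum-of-steps V U V W (P (p - + 1)) (P (p - + 2)) (P (p - + 3)) V-step n)
                  (sum-of-steps W U V W (P (p - + 3)) (P (p - + 4)) (P (p - + 5)) W-step n))
          (det3-cong₁ (P (p - + 3)) (P (p - + 4)) (P (p - + 2) - + 1) (P (p - + 3))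
                      (P (p - + 4)) (P (p - + 5) - + 1)
                      (cong₂ (λ i j → X i - X j) (endpoint n) startpoint)
                      (cong₂ (λ i j → X (i + + 1) - X (j + + 1)) (endpoint n) startpoint)
                      (cong₂ (λ i j → X (i - + 1) - X (j - + 1)) (endpoint n) startpoint))

-- A quadratic form that grows by x² when (x, y, z) is advanced to (y, z, y + x),
-- i.e. along every solution of the recurrence.
energy : ℤ → ℤ → ℤ → ℤ
energy x y z = - (+ 2 * x * x) - y * y - z * z + + 2 * x * z + + 2 * y * z

energy-step : ∀ x y z → energy y z (y + x) ≡ energy x y z + x * x
energy-step = expanded
  where
  expanded : ∀ x y z →
    - (+ 2 * y * y) - z * z - (y + x) * (y + x) + + 2 * y * (y + x) + + 2 * z * (y + x)
      ≡ - (+ 2 * x * x) - y * y - z * z + + 2 * x * z + + 2 * y * z + x * x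
  expanded = solve-∀

square-nonneg : ∀ i → + 0 ≤ i * i
square-nonneg (+ zero)  = +≤+ z≤n
square-nonneg (+ suc n) = +≤+ z≤n
square-nonneg -[1+ n ]  = +≤+ z≤n

first≤sumTo : ∀ m (F : ℕ → ℤ) → (∀ i → + 0 ≤ F i) → F 0 ≤ sumTo m F
first≤sumTo zero    F nonneg = ℤP.≤-refl
first≤sumTo (suc m) F nonneg =
  ℤP.≤-trans (first≤sumTo m F nonneg)
    (ℤP.≤-trans (ℤP.≤-reflexive (sym (ℤP.+-identityʳ (sumTo m F))))
                (ℤP.+-monoʳ-≤ (sumTo m F) (nonneg (suc m))))

sum-of-squares-zero : ∀ m (F : ℕ → ℤ) → sumTo m (λ i → F i * F i) ≡ + 0 → F 0 ≡ + 0
sum-of-squares-zero m F sum≡0 = [ id , id ]′ (ℤP.i*j≡0⇒i≡0∨j≡0 (F 0) square≡0)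
  where
  square≡0 : F 0 * F 0 ≡ + 0
  square≡0 = ℤP.≤-antisym
    (ℤP.≤-trans (first≤sumTo m (λ i → F i * F i) (λ i → square-nonneg (F i))) (ℤP.≤-reflexive sum≡0))
    (square-nonneg (F 0))

Periodic : (ℤ → ℤ) → ℤ → Set
Periodic X p = ∀ n → X (n + p) ≡ X n

-- A solution with period m + 1 vanishes at 0: over one period the energy returns
-- to its initial value, so the squares X 0², …, X m² sum to zero.
periodic-vanishes-at-0 : ∀ {X} → Rec X → ∀ m → Periodic X (+ suc m) → X (+ 0) ≡ + 0
periodic-vanishes-at-0 {X} RX m per = sum-of-squares-zero m (λ i → X (+ i)) (begin
  sumTo m (λ i → X (+ i) * X (+ i))  ≡⟨ sym (telescope E _ E-step m) ⟩
  E (suc m) - E 0                    ≡⟨ cong (_- E 0) E-periodic ⟩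
  E 0 - E 0                          ≡⟨ ℤP.+-inverseʳ (E 0) ⟩
  + 0                                ∎)
  where
  E : ℕ → ℤ
  E i = energy (X (+ i)) (X (+ suc i)) (X (+ suc (suc i)))
  E-step : ∀ i → E (suc i) ≡ E i + X (+ i) * X (+ i)
  E-step i = trans (cong (energy (X (+ suc i)) (X (+ suc (suc i)))) (rec-ℕ RX i))
                   (energy-step (X (+ i)) (X (+ suc i)) (X (+ suc (suc i))))
  E-periodic : E (suc m) ≡ E 0
  E-periodic = cong₂ (λ x yz → energy x (proj₁ yz) (proj₂ yz)) (per (+ 0))
                     (cong₂ _,_ (per (+ 1)) (per (+ 2)))

periodic-shift : ∀ {X p} → Periodic X p → ∀ j → Periodic (shift j X) p
periodic-shift {X} {p} per j n = trans (cong X (sym (ℤP.+-assoc j n p))) (per (j + n))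

periodic-neg : ∀ {X p} → Periodic X p → Periodic X (- p)
periodic-neg {X} {p} per n = trans (sym (per (n - p))) (cong X (cancel n p))
  where
  cancel : ∀ n p → n - p + p ≡ n
  cancel = solve-∀

periodic-zero : ∀ {X p} → Rec X → p ≢ + 0 → Periodic X p → ∀ j → X j ≡ + 0
periodic-zero {X} {+ zero}    RX p≢0 per j = ⊥-elim (p≢0 refl)
periodic-zero {X} {+ suc m}   RX p≢0 per j =
  trans (cong X (sym (ℤP.+-identityʳ j)))
        (periodic-vanishes-at-0 (rec-shift RX j) m (periodic-shift per j))
periodic-zero {X} { -[1+ m ]} RX p≢0 per j = periodic-zero RX (λ ()) (periodic-neg per) j

module M-I (p : ℤ) = Matrix3 (P (p - + 2) - + 1) (P (p - + 3)) (P (p - + 4))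
                             (P (p - + 1)) (P (p - + 2) - + 1) (P (p - + 3))
                             (P (p - + 3)) (P (p - + 4)) (P (p - + 5) - + 1)

kernel⇒fixed : ∀ p x y z → M-I.Kernel p x y z →
  (P (p - + 2) * x + P (p - + 3) * y + P (p - + 4) * z ≡ x) ×
  (P (p - + 1) * x + P (p - + 2) * y + P (p - + 3) * z ≡ y) ×
  (P (p - + 3) * x + P (p - + 4) * y + P (p - + 5) * z ≡ z)
kernel⇒fixed p x y z (r₁ , r₂ , r₃) =
  ℤP.i-j≡0⇒i≡j _ _ (trans (regroup₁ (P (p - + 2)) (P (p - + 3)) (P (p - + 4)) x y z) r₁) ,
  ℤP.i-j≡0⇒i≡j _ _ (trans (regroup₂ (P (p - + 1)) (P (p - + 2)) (P (p - + 3)) x y z) r₂) ,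
  ℤP.i-j≡0⇒i≡j _ _ (trans (regroup₃ (P (p - + 3)) (P (p - + 4)) (P (p - + 5)) x y z) r₃)
  where
  regroup₁ : ∀ a b c x y z → a * x + b * y + c * z - x ≡ (a - + 1) * x + b * y + c * z
  regroup₁ = solve-∀
  regroup₂ : ∀ a b c x y z → a * x + b * y + c * z - y ≡ a * x + (b - + 1) * y + c * z
  regroup₂ = solve-∀
  regroup₃ : ∀ a b c x y z → a * x + b * y + c * z - z ≡ a * x + b * y + (c - + 1) * z
  regroup₃ = solve-∀

-- A solution whose window (X 0, X 1, X -1) is a fixed vector of M(p) is p-periodic:
-- X (· + p) and X solve the recurrence and agree at -1, 0, 1.
fixed⇒periodic : ∀ {X} → Rec X → ∀ p → M-I.Kernel p (X (+ 0)) (X (+ 1)) (X -[1+ 0 ]) → Periodic X p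
fixed⇒periodic {X} RX p ker =
  let (fix₀ , fix₁ , fix₋) = kernel⇒fixed p (X (+ 0)) (X (+ 1)) (X -[1+ 0 ]) ker in
  rec-unique (rec-ext (λ n → cong X (ℤP.+-comm p n)) (rec-shift RX p)) RX
    (trans (addition-row RX (+ 0) -[1+ 0 ] p) fix₋ ,
     trans (addition-row RX (+ 0) (+ 0) p) fix₀ ,
     trans (addition-row RX (+ 0) (+ 1) p) fix₁)

-- For p ≠ 0, M(p) - I has trivial kernel: a kernel vector (x, y, z) is the window
-- (X 0, X 1, X -1) of the solution X with X 0 = x, X 1 = y, X 2 = x + z, which is
-- then p-periodic and so vanishes.
kernel-trivial : ∀ p → p ≢ + 0 → M-I.TrivialKernel p
kernel-trivial p p≢0 x y z ker =
  vanishes (+ 0) , vanishes (+ 1) , trans (sym X₋₁≡z) (vanishes -[1+ 0 ])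
  where
  X : ℤ → ℤ
  X = seqℤ (x , y , x + z)
  X₋₁≡z : X -[1+ 0 ] ≡ z
  X₋₁≡z = cancel x z
    where
    cancel : ∀ x z → x + z - x ≡ z
    cancel = solve-∀
  vanishes : ∀ n → X n ≡ + 0
  vanishes = periodic-zero (seqℤ-rec _) p≢0
    (fixed⇒periodic (seqℤ-rec _) p (subst (M-I.Kernel p x y) (sym X₋₁≡z) ker))

denom-nonzero : ∀ p → p ≢ + 0 → denom p ≢ + 0
denom-nonzero p p≢0 = M-I.det3-nonzero p (kernel-trivial p p≢0)

five-step : ∀ {Y} → Rec Y → Y (+ 5) ≡ Y (+ 4) + Y (+ 0)
five-step {Y} RY
  rewrite recurrence RY (+ 2) | recurrence RY (+ 1) | recurrence RY (+ 0) =
    regroup (Y (+ 0)) (Y (+ 1)) (Y (+ 2))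
  where
  regroup : ∀ x₀ x₁ x₂ → x₁ + x₀ + x₂ ≡ x₂ + x₁ + x₀
  regroup = solve-∀

-- The case p = 1: X (j + q + 4) advances by X (j + q), so the sum telescopes.
consecutive-sum : ∀ {X} → Rec X → ∀ q n →
  sumTo n (λ j → X (+ j + q)) ≡ X (+ n + q + + 5) - X (q + + 4)
consecutive-sum {X} RX q n = sym (begin
  X (+ n + q + + 5) - X (q + + 4)            ≡⟨ cong₂ (λ i k → X i - X k) (sym (next (+ n) q))
                                                       (cong (_+ + 4) (sym (ℤP.+-identityˡ q))) ⟩
  X (+ suc n + q + + 4) - X (+ 0 + q + + 4)  ≡⟨ telescope (λ j → X (+ j + q + + 4)) _ step n ⟩
  sumTo n (λ j → X (+ j + q))                ∎)
  where
  next : ∀ n q → + 1 + n + q + + 4 ≡ n + q + + 5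
  next = solve-∀
  step : ∀ j → X (+ suc j + q + + 4) ≡ X (+ j + q + + 4) + X (+ j + q)
  step j = begin
    X (+ suc j + q + + 4)                    ≡⟨ cong X (next (+ j) q) ⟩
    X (+ j + q + + 5)                        ≡⟨ five-step (rec-shift RX (+ j + q)) ⟩
    X (+ j + q + + 4) + X (+ j + q + + 0)    ≡⟨ cong (λ i → X (+ j + q + + 4) + X i)
                                                     (ℤP.+-identityʳ _) ⟩
    X (+ j + q + + 4) + X (+ j + q)          ∎

mainTheorem1 : (p q : ℤ) → (n : ℕ) → p ≢ + 0 →
    (denom p ≢ + 0)
    × (sumTo n (λ j → P (p * + j + q)) * denom p ≡ numer P p q n)
    × (sumTo n (λ j → Q (p * + j + q)) * denom p ≡ numer Q p q n)
    × (sumTo n (λ j → P (+ j + q)) ≡ P (+ n + q + + 5) - P (q + + 4))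
    × (sumTo n (λ j → Q (+ j + q)) ≡ Q (+ n + q + + 5) - Q (q + + 4))
mainTheorem1 p q n p≢0 =
  denom-nonzero p p≢0 ,
  SumFormula.sum-formula P-rec p q n ,
  SumFormula.sum-formula Q-rec p q n ,
  consecutive-sum P-rec q n ,
  consecutive-sum Q-rec q n
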